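{- For a graph $G$, $\gamma_{(2,2,0)}(G)=3$ if and only if $\gamma_{\times2,t}(G)=\gamma(G)+1=3$.
   Context: All graphs are finite and simple; $N(v)$ is the open neighbourhood and $f(S)=\sum_{u\in S}f(u)$. $\gamma_{(2,2,0)}(G)$ is the minimum of $\sum_v f(v)$ over functions $f:V(G)\to\{0,1,2\}$ such that $f(N(v))\ge2$ whenever $f(v)\in\{0,1\}$ (no condition when $f(v)=2$). $\gamma(G)$ is the domination number; $\gamma_{\times2,t}(G)$ is the double total domination number (minimum size of a set $D$ such that every vertex has at least two neighbours in $D$), defined for graphs of minimum degree at least $2$. -}

module Defs where

open import Data.Nat using (ℕ; zero; suc; _+_; _≤_; _<_)
open import Data.Bool using (Bool; true; false; if_then_else_; _∧_)
open import Data.Fin using (Fin; zero; suc)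
open import Data.Fin.Subset using (Subset; ∣_∣)
open import Data.Vec using (lookup)
open import Data.Product using (Σ; _×_; _,_)
open import Data.Sum using (_⊎_)
open import Relation.Binary.PropositionalEquality using (_≡_)

record Graph (n : ℕ) : Set where
  field
    adj    : Fin n → Fin n → Bool
    sym    : ∀ u v → adj u v ≡ adj v u
    irrefl : ∀ v → adj v v ≡ false
open Graph public

sumFin : {n : ℕ} → (Fin n → ℕ) → ℕ
sumFin {zero}  f = 0
sumFin {suc n} f = f zero + sumFin (λ i → f (suc i))

nbhdSum : {n : ℕ} → Graph n → (Fin n → ℕ) → Fin n → ℕ
nbhdSum G f v = sumFin (λ u → if adj G v u then f u else 0)

nbrsIn : {n : ℕ} → Graph n → Subset n → Fin n → ℕ
nbrsIn G D v = sumFin (λ u → if adj G v u ∧ lookup D u then 1 else 0)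

Is220DomFun : {n : ℕ} → Graph n → (Fin n → ℕ) → Set
Is220DomFun G f = ∀ v → f v ≤ 2 × (f v < 2 → 2 ≤ nbhdSum G f v)

weight : {n : ℕ} → (Fin n → ℕ) → ℕ
weight f = sumFin f

γ220≡ : {n : ℕ} → Graph n → ℕ → Set
γ220≡ G k = Σ _ (λ f → Is220DomFun G f × weight f ≡ k)
            × (∀ f → Is220DomFun G f → k ≤ weight f)

IsDomSet : {n : ℕ} → Graph n → Subset n → Set
IsDomSet G D = ∀ v → lookup D v ≡ true ⊎ 1 ≤ nbrsIn G D v

γ≡ : {n : ℕ} → Graph n → ℕ → Set
γ≡ G k = Σ _ (λ D → IsDomSet G D × ∣ D ∣ ≡ k)
         × (∀ D → IsDomSet G D → k ≤ ∣ D ∣)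

IsDTDomSet : {n : ℕ} → Graph n → Subset n → Set
IsDTDomSet G D = ∀ v → 2 ≤ nbrsIn G D v

-- γ_{×2,t}(G) = k : such sets exist (which forces δ(G) ≥ 2) and k is the minimum size.
γ×2t≡ : {n : ℕ} → Graph n → ℕ → Set
γ×2t≡ G k = Σ _ (λ D → IsDTDomSet G D × ∣ D ∣ ≡ k)
            × (∀ D → IsDTDomSet G D → k ≤ ∣ D ∣)

-- Write a (2,2,0)-dominating function f as 2·1_T + 1_O, where T and O are the
-- vertices of value 2 and 1. If O has at most one vertex, T is a dominating set.
-- Conversely 1_D for a double total dominating set D and 2·1_D for a dominating
-- set D are (2,2,0)-dominating functions, so γ_(2,2,0) ≤ min(γ_{×2,t}, 2γ).
-- A vertex of value 1 forces weight at least 3, so a function of weight ≤ 2 has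
-- O = ∅ and is 2·1_T with T dominating; hence γ = 2 gives γ_(2,2,0) ≥ 3.
-- If γ_(2,2,0) = 3, then 2|T| + |O| = 3: the case |T| = |O| = 1 would make 2·1_T
-- of weight 2 admissible, so T = ∅ and O is a double total dominating set of
-- size 3, and deleting any vertex of O leaves a dominating set of size 2.
module Submission where

open import Defs hiding (sym)
open import Data.Bool using (Bool; true; false; if_then_else_; _∧_)
open import Data.Bool.Properties using (T-≡)
open import Data.Fin using (Fin; zero; suc)
open import Data.Fin.Subset using (Subset; ∣_∣; _∈_; _─_; _-_; ⁅_⁆; Nonempty)
open import Data.Fin.Subset.Properties
  using (nonempty?; Empty-unique; ∣⊥∣≡0; ∣⁅x⁆∣≡1; x∈p⇒∣p-x∣<∣p∣)
open import Data.Nat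
  using (ℕ; zero; suc; _+_; _*_; _≤_; _<_; z≤n; s≤s; s≤s⁻¹; z<s; _≡ᵇ_; _<?_; _≤?_)
open import Data.Nat.Properties
open import Algebra.Properties.CommutativeSemigroup +-commutativeSemigroup
  using (interchange; x∙yz≈y∙xz)
open import Data.Product using (_×_; _,_; proj₁; proj₂)
open import Data.Sum using (_⊎_; inj₁; inj₂)
open import Data.Vec using ([]; _∷_; lookup; tabulate)
open import Data.Vec.Properties using (lookup∘tabulate; []=⇒lookup)
open import Function.Base using (_∘_)
open import Function.Bundles using (_⇔_; mk⇔; Equivalence)
open import Relation.Nullary using (yes; no; contradiction)
open import Relation.Binary.PropositionalEquality
  using (_≡_; refl; sym; trans; cong; cong₂; subst; subst₂; module ≡-Reasoning)

2≤2a+b⇒1≤a : ∀ a {b} → 2 ≤ 2 * a + b → b ≤ 1 → 1 ≤ a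
2≤2a+b⇒1≤a zero    2≤b b≤1 = contradiction (≤-trans 2≤b b≤1) (<-irrefl refl)
2≤2a+b⇒1≤a (suc a) _   _   = s≤s z≤n

3≤2d⇒2≤d : ∀ d → 3 ≤ 2 * d → 2 ≤ d
3≤2d⇒2≤d 0             ()
3≤2d⇒2≤d 1             (s≤s (s≤s ()))
3≤2d⇒2≤d (suc (suc d)) _ = s≤s (s≤s z≤n)

2t+o≡3⇒ : ∀ t o → 2 * t + o ≡ 3 → (t ≡ 0 × o ≡ 3) ⊎ (t ≡ 1 × o ≡ 1)
2t+o≡3⇒ 0             o eq = inj₁ (refl , eq)
2t+o≡3⇒ 1             o eq = inj₂ (refl , suc-injective (suc-injective eq))
2t+o≡3⇒ (suc (suc t)) o eq = contradiction (subst (4 ≤_) eq (≤-trans (*-monoʳ-≤ 2 (s≤s (s≤s z≤n))) (m≤m+n _ o)))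
                                           (<-irrefl refl)

sumFin-cong : ∀ {n} {f g : Fin n → ℕ} → (∀ u → f u ≡ g u) → sumFin f ≡ sumFin g
sumFin-cong {zero}  f≗g = refl
sumFin-cong {suc n} f≗g = cong₂ _+_ (f≗g zero) (sumFin-cong (f≗g ∘ suc))

sumFin-mono : ∀ {n} {f g : Fin n → ℕ} → (∀ u → f u ≤ g u) → sumFin f ≤ sumFin g
sumFin-mono {zero}  f≤g = z≤n
sumFin-mono {suc n} f≤g = +-mono-≤ (f≤g zero) (sumFin-mono (f≤g ∘ suc))

sumFin-+ : ∀ {n} (f g : Fin n → ℕ) → sumFin (λ u → f u + g u) ≡ sumFin f + sumFin g
sumFin-+ {zero}  f g = refl
sumFin-+ {suc n} f g = trans (cong (f zero + g zero +_) (sumFin-+ (f ∘ suc) (g ∘ suc)))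
                             (interchange (f zero) (g zero) _ _)

sumFin-*ˡ : ∀ {n} k (f : Fin n → ℕ) → sumFin (λ u → k * f u) ≡ k * sumFin f
sumFin-*ˡ {zero}  k f = sym (*-zeroʳ k)
sumFin-*ˡ {suc n} k f = trans (cong (k * f zero +_) (sumFin-*ˡ k (f ∘ suc)))
                              (sym (*-distribˡ-+ k (f zero) _))

term≤sumFin : ∀ {n} (f : Fin n → ℕ) u → f u ≤ sumFin f
term≤sumFin f zero    = m≤m+n (f zero) _
term≤sumFin f (suc u) = m≤n⇒m≤o+n (f zero) (term≤sumFin (f ∘ suc) u)

sumFin-mono-with-gap : ∀ {n} {f g : Fin n → ℕ} v →
  (∀ u → g u ≤ f u) → g v ≡ 0 → f v + sumFin g ≤ sumFin f
sumFin-mono-with-gap {suc n} zero g≤f gv≡0 rewrite gv≡0 =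
  +-monoʳ-≤ _ (sumFin-mono (g≤f ∘ suc))
sumFin-mono-with-gap {suc n} {f} {g} (suc v) g≤f gv≡0 = begin
  f (suc v) + (g zero + sumFin (g ∘ suc)) ≡⟨ x∙yz≈y∙xz (f (suc v)) (g zero) _ ⟩
  g zero + (f (suc v) + sumFin (g ∘ suc)) ≤⟨ +-mono-≤ (g≤f zero) (sumFin-mono-with-gap v (g≤f ∘ suc) gv≡0) ⟩
  f zero + sumFin (f ∘ suc)               ∎
  where open ≤-Reasoning

masked : Bool → ℕ → ℕ
masked b x = if b then x else 0

masked-+ : ∀ b x y → masked b (x + y) ≡ masked b x + masked b y
masked-+ true  x y = refl
masked-+ false x y = refl

masked-*ˡ : ∀ b k x → masked b (k * x) ≡ k * masked b x
masked-*ˡ true  k x = refl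
masked-*ˡ false k x = sym (*-zeroʳ k)

masked-mono : ∀ b {x y} → x ≤ y → masked b x ≤ masked b y
masked-mono true  x≤y = x≤y
masked-mono false x≤y = z≤n

masked≤ : ∀ b x → masked b x ≤ x
masked≤ true  x = ≤-refl
masked≤ false x = z≤n

indicator : ∀ {n} → Subset n → Fin n → ℕ
indicator D u = masked (lookup D u) 1

indicator≤1 : ∀ {n} (D : Subset n) u → indicator D u ≤ 1
indicator≤1 D u = masked≤ (lookup D u) 1

weight-indicator : ∀ {n} (D : Subset n) → weight (indicator D) ≡ ∣ D ∣
weight-indicator []          = refl
weight-indicator (true  ∷ D) = cong suc (weight-indicator D)
weight-indicator (false ∷ D) = weight-indicator D

indicator-─ : ∀ {n} (p q : Subset n) u → indicator p u ≤ indicator (p ─ q) u + indicator q u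
indicator-─ (true  ∷ p) (true  ∷ q) zero    = ≤-refl
indicator-─ (true  ∷ p) (false ∷ q) zero    = ≤-refl
indicator-─ (false ∷ p) (_     ∷ q) zero    = z≤n
indicator-─ (_     ∷ p) (_     ∷ q) (suc u) = indicator-─ p q u

∣p∣>0⇒Nonempty : ∀ {n} (p : Subset n) → 0 < ∣ p ∣ → Nonempty p
∣p∣>0⇒Nonempty {n} p ∣p∣>0 with nonempty? p
... | yes ne    = ne
... | no  empty = contradiction (trans (cong ∣_∣ (Empty-unique empty)) (∣⊥∣≡0 n)) (>⇒≢ ∣p∣>0)

levelSet : ∀ {n} → (Fin n → ℕ) → ℕ → Subset n
levelSet f k = tabulate (λ u → f u ≡ᵇ k)

lookup-levelSet : ∀ {n} (f : Fin n → ℕ) k u → lookup (levelSet f k) u ≡ (f u ≡ᵇ k)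
lookup-levelSet f k = lookup∘tabulate (λ u → f u ≡ᵇ k)

∈levelSet⇒ : ∀ {n} (f : Fin n → ℕ) {k u} → u ∈ levelSet f k → f u ≡ k
∈levelSet⇒ f {k} {u} u∈ =
  ≡ᵇ⇒≡ (f u) k (Equivalence.from T-≡ (trans (sym (lookup-levelSet f k u)) ([]=⇒lookup u∈)))

≤2⇒levelSplit : ∀ x → x ≤ 2 → x ≡ 2 * masked (x ≡ᵇ 2) 1 + masked (x ≡ᵇ 1) 1
≤2⇒levelSplit 0 _ = refl
≤2⇒levelSplit 1 _ = refl
≤2⇒levelSplit 2 _ = refl
≤2⇒levelSplit (suc (suc (suc x))) (s≤s (s≤s ()))

levelSplit : ∀ {n} (f : Fin n → ℕ) → (∀ u → f u ≤ 2) →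
  ∀ u → f u ≡ 2 * indicator (levelSet f 2) u + indicator (levelSet f 1) u
levelSplit f f≤2 u rewrite lookup-levelSet f 2 u | lookup-levelSet f 1 u =
  ≤2⇒levelSplit (f u) (f≤2 u)

weight-levelSplit : ∀ {n} (f : Fin n → ℕ) → (∀ u → f u ≤ 2) →
  weight f ≡ 2 * ∣ levelSet f 2 ∣ + ∣ levelSet f 1 ∣
weight-levelSplit {n} f f≤2 = begin
  weight f                                                      ≡⟨ sumFin-cong (levelSplit f f≤2) ⟩
  sumFin (λ u → 2 * indicator T u + indicator O u)              ≡⟨ sumFin-+ (λ u → 2 * indicator T u) (indicator O) ⟩
  sumFin (λ u → 2 * indicator T u) + weight (indicator O)       ≡⟨ cong₂ _+_ (sumFin-*ˡ 2 (indicator T)) (weight-indicator O) ⟩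
  2 * weight (indicator T) + ∣ O ∣                              ≡⟨ cong (λ t → 2 * t + ∣ O ∣) (weight-indicator T) ⟩
  2 * ∣ T ∣ + ∣ O ∣                                             ∎
  where
  open ≡-Reasoning
  T O : Subset n
  T = levelSet f 2
  O = levelSet f 1

module _ {n : ℕ} (G : Graph n) where

  nbhdSum-cong : ∀ {f g : Fin n → ℕ} v → (∀ u → f u ≡ g u) → nbhdSum G f v ≡ nbhdSum G g v
  nbhdSum-cong v f≗g = sumFin-cong (λ u → cong (masked (adj G v u)) (f≗g u))

  nbhdSum-mono : ∀ {f g : Fin n → ℕ} v → (∀ u → f u ≤ g u) → nbhdSum G f v ≤ nbhdSum G g v
  nbhdSum-mono v f≤g = sumFin-mono (λ u → masked-mono (adj G v u) (f≤g u))

  nbhdSum-+ : ∀ (f g : Fin n → ℕ) v →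
    nbhdSum G (λ u → f u + g u) v ≡ nbhdSum G f v + nbhdSum G g v
  nbhdSum-+ f g v = trans (sumFin-cong (λ u → masked-+ (adj G v u) (f u) (g u)))
                          (sumFin-+ (λ u → masked (adj G v u) (f u)) (λ u → masked (adj G v u) (g u)))

  nbhdSum-*ˡ : ∀ k (f : Fin n → ℕ) v → nbhdSum G (λ u → k * f u) v ≡ k * nbhdSum G f v
  nbhdSum-*ˡ k f v = trans (sumFin-cong (λ u → masked-*ˡ (adj G v u) k (f u)))
                           (sumFin-*ˡ k (λ u → masked (adj G v u) (f u)))

  closedNbhdSum≤weight : ∀ (f : Fin n → ℕ) v → f v + nbhdSum G f v ≤ weight f
  closedNbhdSum≤weight f v =
    sumFin-mono-with-gap v (λ u → masked≤ (adj G v u) (f u)) (cong (λ b → masked b (f v)) (irrefl G v))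

  nbhdSum≤weight : ∀ (f : Fin n → ℕ) v → nbhdSum G f v ≤ weight f
  nbhdSum≤weight f v = m+n≤o⇒n≤o (f v) (closedNbhdSum≤weight f v)

  nbhdSum-indicator : ∀ (D : Subset n) v → nbhdSum G (indicator D) v ≡ nbrsIn G D v
  nbhdSum-indicator D v = sumFin-cong (λ u → masked-∧ (adj G v u) (lookup D u))
    where
    masked-∧ : ∀ a b → masked a (masked b 1) ≡ (if a ∧ b then 1 else 0)
    masked-∧ true  b = refl
    masked-∧ false b = refl

  nbrsIn≤∣∣ : ∀ (D : Subset n) v → nbrsIn G D v ≤ ∣ D ∣
  nbrsIn≤∣∣ D v = subst₂ _≤_ (nbhdSum-indicator D v) (weight-indicator D) (nbhdSum≤weight (indicator D) v)

  nbrsIn-─ : ∀ (p q : Subset n) v → nbrsIn G p v ≤ nbrsIn G (p ─ q) v + nbrsIn G q v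
  nbrsIn-─ p q v = begin
    nbrsIn G p v                                                      ≡⟨ sym (nbhdSum-indicator p v) ⟩
    nbhdSum G (indicator p) v                                         ≤⟨ nbhdSum-mono v (indicator-─ p q) ⟩
    nbhdSum G (λ u → indicator (p ─ q) u + indicator q u) v           ≡⟨ nbhdSum-+ (indicator (p ─ q)) (indicator q) v ⟩
    nbhdSum G (indicator (p ─ q)) v + nbhdSum G (indicator q) v       ≡⟨ cong₂ _+_ (nbhdSum-indicator (p ─ q) v) (nbhdSum-indicator q v) ⟩
    nbrsIn G (p ─ q) v + nbrsIn G q v                                 ∎
    where open ≤-Reasoning

  DTDomSet⇒220DomFun : ∀ D → IsDTDomSet G D → Is220DomFun G (indicator D)
  DTDomSet⇒220DomFun D dt v =
    ≤-trans (indicator≤1 D v) (n≤1+n 1) , λ _ → subst (2 ≤_) (sym (nbhdSum-indicator D v)) (dt v)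

  DomSet⇒220DomFun : ∀ D → IsDomSet G D → Is220DomFun G (λ u → 2 * indicator D u)
  DomSet⇒220DomFun D dom v = *-monoʳ-≤ 2 (indicator≤1 D v) , neighbours
    where
    neighbours : 2 * indicator D v < 2 → 2 ≤ nbhdSum G (λ u → 2 * indicator D u) v
    neighbours light with lookup D v | dom v
    ... | true  | _         = contradiction light (<-irrefl refl)
    ... | false | inj₂ 1≤nD = subst (2 ≤_) (sym (trans (nbhdSum-*ˡ 2 (indicator D) v) (cong (2 *_) (nbhdSum-indicator D v))))
                                    (*-monoʳ-≤ 2 1≤nD)

  DTDomSet-minus-vertex : ∀ D → IsDTDomSet G D → ∀ c → IsDomSet G (D - c)
  DTDomSet-minus-vertex D dt c v = inj₂ (+-cancelʳ-≤ 1 1 _ (begin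
    2                                    ≤⟨ dt v ⟩
    nbrsIn G D v                         ≤⟨ nbrsIn-─ D ⁅ c ⁆ v ⟩
    nbrsIn G (D - c) v + nbrsIn G ⁅ c ⁆ v ≤⟨ +-monoʳ-≤ _ (≤-trans (nbrsIn≤∣∣ ⁅ c ⁆ v) (≤-reflexive (∣⁅x⁆∣≡1 c))) ⟩
    nbrsIn G (D - c) v + 1               ∎))
    where open ≤-Reasoning

  Is220LowerBound : ℕ → Set
  Is220LowerBound k = ∀ f → Is220DomFun G f → k ≤ weight f

  220-bound⇒DTDomSet-bound : ∀ {k} D → Is220LowerBound k → IsDTDomSet G D → k ≤ ∣ D ∣
  220-bound⇒DTDomSet-bound {k} D bound dt =
    subst (k ≤_) (weight-indicator D) (bound (indicator D) (DTDomSet⇒220DomFun D dt))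

  220-bound⇒DomSet-bound : ∀ {k} D → Is220LowerBound k → IsDomSet G D → k ≤ 2 * ∣ D ∣
  220-bound⇒DomSet-bound {k} D bound dom =
    subst (k ≤_) (trans (sumFin-*ˡ 2 (indicator D)) (cong (2 *_) (weight-indicator D)))
          (bound (λ u → 2 * indicator D u) (DomSet⇒220DomFun D dom))

  nbhdSum-levelSplit : ∀ (f : Fin n → ℕ) → (∀ u → f u ≤ 2) →
    ∀ v → nbhdSum G f v ≡ 2 * nbrsIn G (levelSet f 2) v + nbrsIn G (levelSet f 1) v
  nbhdSum-levelSplit f f≤2 v = begin
    nbhdSum G f v                                                  ≡⟨ nbhdSum-cong v (levelSplit f f≤2) ⟩
    nbhdSum G (λ u → 2 * indicator T u + indicator O u) v          ≡⟨ nbhdSum-+ (λ u → 2 * indicator T u) (indicator O) v ⟩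
    nbhdSum G (λ u → 2 * indicator T u) v + nbhdSum G (indicator O) v
                                                                   ≡⟨ cong₂ _+_ (nbhdSum-*ˡ 2 (indicator T) v) (nbhdSum-indicator O v) ⟩
    2 * nbhdSum G (indicator T) v + nbrsIn G O v                   ≡⟨ cong (λ t → 2 * t + nbrsIn G O v) (nbhdSum-indicator T v) ⟩
    2 * nbrsIn G T v + nbrsIn G O v                                ∎
    where
    open ≡-Reasoning
    T O : Subset n
    T = levelSet f 2
    O = levelSet f 1

  light-vertex-weight : ∀ {f} → Is220DomFun G f → ∀ v → f v < 2 → f v + 2 ≤ weight f
  light-vertex-weight {f} hf v light =
    ≤-trans (+-monoʳ-≤ (f v) (proj₂ (hf v) light)) (closedNbhdSum≤weight f v)

  weight<3⇒no-ones : ∀ {f} → Is220DomFun G f → weight f < 3 → ∣ levelSet f 1 ∣ ≡ 0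
  weight<3⇒no-ones {f} hf w<3 with ∣ levelSet f 1 ∣ in ∣O∣≡
  ... | zero  = refl
  ... | suc _ with ∣p∣>0⇒Nonempty (levelSet f 1) (subst (0 <_) (sym ∣O∣≡) z<s)
  ... | u , u∈O = contradiction w<3 (≤⇒≯ (subst (λ x → x + 2 ≤ weight f) fu≡1 (light-vertex-weight hf u light)))
    where
    fu≡1 : f u ≡ 1
    fu≡1 = ∈levelSet⇒ f u∈O
    light : f u < 2
    light = subst (_< 2) (sym fu≡1) (n<1+n 1)

  twos-dominate : ∀ {f} → Is220DomFun G f → ∣ levelSet f 1 ∣ ≤ 1 → IsDomSet G (levelSet f 2)
  twos-dominate {f} hf ∣O∣≤1 v with f v <? 2
  ... | yes light = inj₂ (2≤2a+b⇒1≤a _ (subst (2 ≤_) (nbhdSum-levelSplit f (proj₁ ∘ hf) v) (proj₂ (hf v) light))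
                                       (≤-trans (nbrsIn≤∣∣ (levelSet f 1) v) ∣O∣≤1))
  ... | no  heavy = inj₁ (trans (lookup-levelSet f 2 v)
                         (Equivalence.to T-≡ (≡⇒≡ᵇ (f v) 2 (≤-antisym (proj₁ (hf v)) (≮⇒≥ heavy)))))

  no-twos⇒ones-DTDomSet : ∀ {f} → Is220DomFun G f → ∣ levelSet f 2 ∣ ≡ 0 → IsDTDomSet G (levelSet f 1)
  no-twos⇒ones-DTDomSet {f} hf ∣T∣≡0 v = subst (2 ≤_) nbhd≡ (proj₂ (hf v) light)
    where
    T O : Subset n
    T = levelSet f 2
    O = levelSet f 1
    vanishes : ∀ {x} → x ≤ ∣ T ∣ → x ≡ 0
    vanishes {x} x≤∣T∣ = n≤0⇒n≡0 (subst (x ≤_) ∣T∣≡0 x≤∣T∣)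
    light : f v < 2
    light = begin-strict
      f v                               ≡⟨ levelSplit f (proj₁ ∘ hf) v ⟩
      2 * indicator T v + indicator O v ≡⟨ cong (λ t → 2 * t + indicator O v)
                                                (vanishes (subst (indicator T v ≤_) (weight-indicator T) (term≤sumFin (indicator T) v))) ⟩
      indicator O v                     ≤⟨ indicator≤1 O v ⟩
      1                                 <⟨ n<1+n 1 ⟩
      2                                 ∎
      where open ≤-Reasoning
    nbhd≡ : nbhdSum G f v ≡ nbrsIn G O v
    nbhd≡ = trans (nbhdSum-levelSplit f (proj₁ ∘ hf) v)
                  (cong (λ t → 2 * t + nbrsIn G O v) (vanishes (nbrsIn≤∣∣ T v)))

  γ220≡3⇒γ×2t≡3∧γ≡2 : γ220≡ G 3 → γ×2t≡ G 3 × γ≡ G 2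
  γ220≡3⇒γ×2t≡3∧γ≡2 ((f , hf , wf) , bound)
    with 2t+o≡3⇒ _ _ (trans (sym (weight-levelSplit f (proj₁ ∘ hf))) wf)
  ... | inj₂ (∣T∣≡1 , ∣O∣≡1) = contradiction 3≤2 (<-irrefl refl)
    where
    3≤2 : 3 ≤ 2
    3≤2 = subst (λ t → 3 ≤ 2 * t) ∣T∣≡1
                (220-bound⇒DomSet-bound (levelSet f 2) bound (twos-dominate hf (≤-reflexive ∣O∣≡1)))
  ... | inj₁ (∣T∣≡0 , ∣O∣≡3) =
    ((O , no-twos⇒ones-DTDomSet hf ∣T∣≡0 , ∣O∣≡3) , λ D → 220-bound⇒DTDomSet-bound D bound) ,
    ((O - c , O-c-dominates , ∣O-c∣≡2) , domSet-bound)
    where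
    O : Subset n
    O = levelSet f 1
    domSet-bound : ∀ D → IsDomSet G D → 2 ≤ ∣ D ∣
    domSet-bound D dom = 3≤2d⇒2≤d ∣ D ∣ (220-bound⇒DomSet-bound D bound dom)
    O-nonempty : Nonempty O
    O-nonempty = ∣p∣>0⇒Nonempty O (subst (0 <_) (sym ∣O∣≡3) z<s)
    c : Fin n
    c = proj₁ O-nonempty
    O-c-dominates : IsDomSet G (O - c)
    O-c-dominates = DTDomSet-minus-vertex O (no-twos⇒ones-DTDomSet hf ∣T∣≡0) c
    ∣O-c∣≡2 : ∣ O - c ∣ ≡ 2
    ∣O-c∣≡2 = ≤-antisym (s≤s⁻¹ (subst (suc ∣ O - c ∣ ≤_) ∣O∣≡3 (x∈p⇒∣p-x∣<∣p∣ (proj₂ O-nonempty))))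
                        (domSet-bound (O - c) O-c-dominates)

  γ×2t≡3∧γ≡2⇒γ220≡3 : γ×2t≡ G 3 × γ≡ G 2 → γ220≡ G 3
  γ×2t≡3∧γ≡2⇒γ220≡3 (((D , dt , ∣D∣≡3) , _) , (_ , domSet-bound)) =
    (indicator D , DTDomSet⇒220DomFun D dt , trans (weight-indicator D) ∣D∣≡3) , weight≥3
    where
    weight≥3 : Is220LowerBound 3
    weight≥3 f hf with 3 ≤? weight f
    ... | yes 3≤w = 3≤w
    ... | no  3≰w = contradiction (begin
      3                                   ≤⟨ n≤1+n 3 ⟩
      2 * 2                               ≤⟨ *-monoʳ-≤ 2 (domSet-bound T T-dominates) ⟩
      2 * ∣ T ∣                           ≤⟨ m≤m+n _ _ ⟩
      2 * ∣ T ∣ + ∣ levelSet f 1 ∣        ≡⟨ sym (weight-levelSplit f (proj₁ ∘ hf)) ⟩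
      weight f                            ∎) 3≰w
      where
      open ≤-Reasoning
      T : Subset n
      T = levelSet f 2
      T-dominates : IsDomSet G T
      T-dominates = twos-dominate hf (subst (_≤ 1) (sym (weight<3⇒no-ones hf (≰⇒> 3≰w))) z≤n)

theorem3p29 : (n : ℕ) (G : Graph n) →
    γ220≡ G 3 ⇔ (γ×2t≡ G 3 × γ≡ G 2)
theorem3p29 _ G = mk⇔ (γ220≡3⇒γ×2t≡3∧γ≡2 G) (γ×2t≡3∧γ≡2⇒γ220≡3 G)
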